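{- Let $B=B(a,b,c,d)$ be a box. If $B$ has no corners, then $b-a$ and $d-c$ are both even and $B$ is congruent to $\hat B(b-a,d-c)$. Otherwise, $B$ is congruent to $B(b-a,d-c)$.
   Context: $X$ is the graph with vertex set $\mathbb{Z}^2$ in which $(x,y)$ and $(x',y')$ are adjacent iff $|x-x'|+|y-y'|=1$; two sets are congruent if some graph automorphism of $X$ maps one onto the other. For integers $a,b,c,d$, $B(a,b,c,d)=\{(x,y)\in\mathbb{Z}^2: a\le y-x\le b,\ c\le y+x\le d\}$; a box is a nonempty set of this form, written with $a,c$ maximal and $b,d$ minimal among all choices giving the same set. Its extremal lines are the integer solution sets of $y-x=a$, $y-x=b$, $y+x=c$, $y+x=d$; a corner is a point of $B$ lying on two distinct extremal lines. $B(\alpha,\beta)=B(0,\alpha,0,\beta)$ and, for even $\alpha,\beta$, $\hat B(\alpha,\beta)=B(0,\alpha,-1,\beta-1)$. -}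

module Defs where

open import Data.Integer using (ℤ; _+_; _-_; -_; _≤_; ∣_∣; +_; -[1+_])
open import Data.Integer.Divisibility using (_∣_)
open import Data.Nat using (ℕ)
import Data.Nat as ℕ
open import Data.Fin using (Fin; zero; suc)
open import Data.Product using (_×_; _,_; Σ; ∃; proj₁; proj₂)
open import Relation.Binary.PropositionalEquality using (_≡_; _≢_)
open import Relation.Nullary using (¬_)
open import Function.Definitions using (Bijective)

Point : Set
Point = ℤ × ℤ

Subset : Set₁
Subset = Point → Set

SameSet : Subset → Subset → Set
SameSet S T = ∀ p → (S p → T p) × (T p → S p)

Adj : Point → Point → Set
Adj (x , y) (x' , y') = ∣ x - x' ∣ ℕ.+ ∣ y - y' ∣ ≡ 1

IsAutomorphism : (Point → Point) → Set
IsAutomorphism f = Bijective _≡_ _≡_ f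
                 × (∀ p q → (Adj p q → Adj (f p) (f q)) × (Adj (f p) (f q) → Adj p q))

Congruent : Subset → Subset → Set
Congruent S T = Σ (Point → Point) λ f → IsAutomorphism f
              × (∀ p → S p → T (f p))
              × (∀ q → T q → Σ Point λ p → S p × f p ≡ q)

Bx : ℤ → ℤ → ℤ → ℤ → Subset
Bx a b c d (x , y) = (a ≤ y - x × y - x ≤ b) × (c ≤ y + x × y + x ≤ d)

Nonempty : Subset → Set
Nonempty S = Σ Point S

IsBox : ℤ → ℤ → ℤ → ℤ → Set
IsBox a b c d = Nonempty (Bx a b c d)
  × (∀ a' b' c' d' → SameSet (Bx a b c d) (Bx a' b' c' d')
       → (a' ≤ a) × (b ≤ b') × (c' ≤ c) × (d ≤ d'))

ExtremalLine : ℤ → ℤ → ℤ → ℤ → Fin 4 → Subset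
ExtremalLine a b c d zero                   (x , y) = y - x ≡ a
ExtremalLine a b c d (suc zero)             (x , y) = y - x ≡ b
ExtremalLine a b c d (suc (suc zero))       (x , y) = y + x ≡ c
ExtremalLine a b c d (suc (suc (suc zero))) (x , y) = y + x ≡ d

IsCorner : ℤ → ℤ → ℤ → ℤ → Point → Set
IsCorner a b c d p = Bx a b c d p
  × Σ (Fin 4) λ i → Σ (Fin 4) λ j →
      ¬ SameSet (ExtremalLine a b c d i) (ExtremalLine a b c d j)
      × ExtremalLine a b c d i p × ExtremalLine a b c d j p

HasCorner : ℤ → ℤ → ℤ → ℤ → Set
HasCorner a b c d = Σ Point (IsCorner a b c d)

Bαβ : ℤ → ℤ → Subset
Bαβ α β = Bx (+ 0) α (+ 0) β

B̂αβ : ℤ → ℤ → Subset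
B̂αβ α β = Bx (+ 0) α (-[1+ 0 ]) (β - + 1)

Even : ℤ → Set
Even n = + 2 ∣ n

-- In the diagonal coordinates u = y - x, v = y + x a box is the set of points
-- (u , v) ∈ [a , b] × [c , d] with u + v even, and a corner is such a point with
-- u ∈ {a , b} and v ∈ {c , d}. Translations act on (u , v) by translations, and
-- the reflections in the two diagonals negate u and v respectively, so reflecting
-- a corner into the lower-left position and translating it to the origin maps the
-- box onto B(b - a , d - c). If there is no corner, every sum of an endpoint in
-- {a , b} and one in {c , d} is odd; hence b - a and d - c are even, and the
-- lattice point (u , v) = (a , c + 1) translated to the origin gives B̂(b - a , d - c).
module Submission where

open import Defs
open import Data.Integer using (ℤ; _-_)
open import Data.Product using (_×_)
open import Relation.Nullary using (¬_)

open import Data.Integer using (_+_; _*_; -_; _≤_; +_; ∣_∣; _%_; _/_)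
open import Data.Integer.Properties
  using (+-monoˡ-≤; +-assoc; neg-mono-≤; neg-cancel-≤; neg-involutive; ∣-i∣≡∣i∣; +-comm; +-inverseʳ; ≤-trans; ≤-refl; abs-*)
open import Data.Integer.Tactic.RingSolver using (solve-∀)
open import Data.Integer.DivMod using (a≡a%n+[a/n]*n; n%d<d)
open import Data.Integer.Divisibility using (divides)
import Data.Nat as ℕ
import Data.Nat.Properties as ℕ
open import Data.Fin using (Fin; zero; suc)
open import Data.Product using (Σ; _,_; proj₁; proj₂)
open import Data.Sum using (_⊎_; inj₁; inj₂)
import Data.Sum as Sum
open import Data.Empty using (⊥-elim)
open import Relation.Binary.PropositionalEquality
import Function.Construct.Composition as Composition

U V : Point → ℤ
U (x , y) = y - x
V (x , y) = y + x

Interval : ℤ → ℤ → ℤ → Set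
Interval a b w = a ≤ w × w ≤ b

Interval-shift : ∀ {a b w} s → Interval a b w → Interval (a - s) (b - s) (w - s)
Interval-shift s (a≤w , w≤b) = +-monoˡ-≤ (- s) a≤w , +-monoˡ-≤ (- s) w≤b

Interval-unshift : ∀ {a b w} s → Interval (a - s) (b - s) (w - s) → Interval a b w
Interval-unshift s (a≤w , w≤b) = ≤-unshift a≤w , ≤-unshift w≤b
  where
  m-n+n≡m : ∀ m n → (m - n) + n ≡ m
  m-n+n≡m = solve-∀
  ≤-unshift : ∀ {m n} → m - s ≤ n - s → m ≤ n
  ≤-unshift {m} {n} h = subst₂ _≤_ (m-n+n≡m m s) (m-n+n≡m n s) (+-monoˡ-≤ s h)

Interval-neg : ∀ {a b w} → Interval a b w → Interval (- b) (- a) (- w)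
Interval-neg (a≤w , w≤b) = neg-mono-≤ w≤b , neg-mono-≤ a≤w

Interval-unneg : ∀ {a b w} → Interval (- b) (- a) (- w) → Interval a b w
Interval-unneg (-b≤-w , -w≤-a) = neg-cancel-≤ -w≤-a , neg-cancel-≤ -b≤-w

endpoint∈Interval : ∀ {a b w} → a ≤ b → w ≡ a ⊎ w ≡ b → Interval a b w
endpoint∈Interval a≤b (inj₁ refl) = ≤-refl , a≤b
endpoint∈Interval a≤b (inj₂ refl) = a≤b , ≤-refl

PreservesAdj : (Point → Point) → Set
PreservesAdj f = ∀ p q → Adj p q → Adj (f p) (f q)

congruent-by-inverse : ∀ {S T : Subset} (f g : Point → Point) →
  (∀ p → g (f p) ≡ p) → (∀ q → f (g q) ≡ q) → PreservesAdj f → PreservesAdj g →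
  (∀ p → S p → T (f p)) → (∀ p → T (f p) → S p) → Congruent S T
congruent-by-inverse {S} {T} f g gf≗id fg≗id f-adj g-adj S⇒T T⇒S =
  f , ((injective , surjective) , λ p q → f-adj p q , reflects-adj p q) ,
  S⇒T , λ q Tq → g q , T⇒S (g q) (subst T (sym (fg≗id q)) Tq) , fg≗id q
  where
  injective : ∀ {p q} → f p ≡ f q → p ≡ q
  injective {p} {q} e = trans (sym (gf≗id p)) (trans (cong g e) (gf≗id q))
  surjective : ∀ q → Σ Point λ p → ∀ {r} → r ≡ p → f r ≡ q
  surjective q = g q , λ { refl → fg≗id q }
  reflects-adj : ∀ p q → Adj (f p) (f q) → Adj p q
  reflects-adj p q A = subst₂ Adj (gf≗id p) (gf≗id q) (g-adj (f p) (f q) A)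

congruent-trans : ∀ {S T R : Subset} → Congruent S T → Congruent T R → Congruent S R
congruent-trans (f , (f-bij , f-adj) , f-fw , f-bk) (g , (g-bij , g-adj) , g-fw , g-bk) =
  (λ p → g (f p)) ,
  (Composition.bijective _≡_ _≡_ _≡_ f-bij g-bij ,
   λ p q → (λ A → proj₁ (g-adj (f p) (f q)) (proj₁ (f-adj p q) A)) ,
           (λ A → proj₂ (f-adj p q) (proj₂ (g-adj (f p) (f q)) A))) ,
  (λ p Sp → g-fw (f p) (f-fw p Sp)) ,
  λ q Rq → let (r , Tr , gr≡q) = g-bk q Rq
               (p , Sp , fp≡r) = f-bk r Tr
           in p , Sp , trans (cong g fp≡r) gr≡q

congruentʳ-Bx : ∀ {S a b c d a' b' c' d'} → a ≡ a' → b ≡ b' → c ≡ c' → d ≡ d' →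
                Congruent S (Bx a b c d) → Congruent S (Bx a' b' c' d')
congruentʳ-Bx refl refl refl refl S≅B = S≅B

_+ᵖ_ : Point → Point → Point
(x , y) +ᵖ (k , l) = x + k , y + l

negᵖ : Point → Point
negᵖ (x , y) = - x , - y

_-ᵖ_ : Point → Point → Point
p -ᵖ k = p +ᵖ (negᵖ k)

Adj-resp-difference : ∀ p q p' q' → p' -ᵖ q' ≡ p -ᵖ q → Adj p q → Adj p' q'
Adj-resp-difference p q p' q' e = subst (λ (s , t) → ∣ s ∣ ℕ.+ ∣ t ∣ ≡ 1) (sym e)

+ᵖ-preserves-Adj : ∀ k → PreservesAdj (_+ᵖ k)
+ᵖ-preserves-Adj k p q = Adj-resp-difference p q (p +ᵖ k) (q +ᵖ k) (translation-invariant p q k)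
  where
  m+k-[n+k]≡m-n : ∀ m n k → (m + k) - (n + k) ≡ m - n
  m+k-[n+k]≡m-n = solve-∀
  translation-invariant : ∀ p q k → (p +ᵖ k) -ᵖ (q +ᵖ k) ≡ p -ᵖ q
  translation-invariant (x , y) (x' , y') (k , l) =
    cong₂ _,_ (m+k-[n+k]≡m-n x x' k) (m+k-[n+k]≡m-n y y' l)

U-translate : ∀ q p → U (q -ᵖ p) ≡ U q - U p
U-translate (x , y) (k , l) = [y-l]-[x-k]≡[y-x]-[l-k] x y k l
  where
  [y-l]-[x-k]≡[y-x]-[l-k] : ∀ x y k l → (y - l) - (x - k) ≡ (y - x) - (l - k)
  [y-l]-[x-k]≡[y-x]-[l-k] = solve-∀

V-translate : ∀ q p → V (q -ᵖ p) ≡ V q - V p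
V-translate (x , y) (k , l) = [y-l]+[x-k]≡[y+x]-[l+k] x y k l
  where
  [y-l]+[x-k]≡[y+x]-[l+k] : ∀ x y k l → (y - l) + (x - k) ≡ (y + x) - (l + k)
  [y-l]+[x-k]≡[y+x]-[l+k] = solve-∀

translate-Bx : ∀ {a b c d u v} p → U p ≡ u → V p ≡ v →
               Congruent (Bx a b c d) (Bx (a - u) (b - u) (c - v) (d - v))
translate-Bx {u = u} {v} p refl refl = congruent-by-inverse (_-ᵖ p) (_+ᵖ p)
  (λ q → cong₂ _,_ (m-n+n≡m _ _) (m-n+n≡m _ _))
  (λ q → cong₂ _,_ (m+n-n≡m _ _) (m+n-n≡m _ _))
  (+ᵖ-preserves-Adj (negᵖ p)) (+ᵖ-preserves-Adj p)
  (λ q (i , j) → subst (Interval _ _) (sym (U-translate q p)) (Interval-shift u i) ,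
                 subst (Interval _ _) (sym (V-translate q p)) (Interval-shift v j))
  (λ q (i , j) → Interval-unshift u (subst (Interval _ _) (U-translate q p) i) ,
                 Interval-unshift v (subst (Interval _ _) (V-translate q p) j))
  where
  m-n+n≡m : ∀ m n → (m - n) + n ≡ m
  m-n+n≡m = solve-∀
  m+n-n≡m : ∀ m n → (m + n) - n ≡ m
  m+n-n≡m = solve-∀

negᵖ-preserves-Adj : PreservesAdj negᵖ
negᵖ-preserves-Adj (x , y) (x' , y') = trans (cong₂ ℕ._+_ (∣-m--n∣≡∣m-n∣ x x') (∣-m--n∣≡∣m-n∣ y y'))
  where
  -m--n≡-[m-n] : ∀ m n → - m - - n ≡ - (m - n)
  -m--n≡-[m-n] = solve-∀
  ∣-m--n∣≡∣m-n∣ : ∀ m n → ∣ - m - - n ∣ ≡ ∣ m - n ∣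
  ∣-m--n∣≡∣m-n∣ m n = trans (cong ∣_∣ (-m--n≡-[m-n] m n)) (∣-i∣≡∣i∣ (m - n))

reflectDiag reflectAntidiag : Point → Point
reflectDiag (x , y) = y , x
reflectAntidiag p = reflectDiag (negᵖ p)

reflectDiag-preserves-Adj : PreservesAdj reflectDiag
reflectDiag-preserves-Adj (x , y) (x' , y') = trans (ℕ.+-comm ∣ y - y' ∣ ∣ x - x' ∣)

reflectAntidiag-preserves-Adj : PreservesAdj reflectAntidiag
reflectAntidiag-preserves-Adj p q A = reflectDiag-preserves-Adj (negᵖ p) (negᵖ q) (negᵖ-preserves-Adj p q A)

U-reflectDiag : ∀ p → U (reflectDiag p) ≡ - U p
U-reflectDiag (x , y) = x-y≡-[y-x] x y
  where
  x-y≡-[y-x] : ∀ x y → x - y ≡ - (y - x)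
  x-y≡-[y-x] = solve-∀

V-reflectDiag : ∀ p → V (reflectDiag p) ≡ V p
V-reflectDiag (x , y) = +-comm x y

-m--n≡n-m : ∀ m n → - m - - n ≡ n - m
-m--n≡n-m = solve-∀

U-reflectAntidiag : ∀ p → U (reflectAntidiag p) ≡ U p
U-reflectAntidiag (x , y) = -m--n≡n-m x y

V-reflectAntidiag : ∀ p → V (reflectAntidiag p) ≡ - V p
V-reflectAntidiag (x , y) = -x+-y≡-[y+x] x y
  where
  -x+-y≡-[y+x] : ∀ x y → - x + - y ≡ - (y + x)
  -x+-y≡-[y+x] = solve-∀

reflectDiag-Bx : ∀ a b c d → Congruent (Bx a b c d) (Bx (- b) (- a) c d)
reflectDiag-Bx a b c d = congruent-by-inverse reflectDiag reflectDiag (λ _ → refl) (λ _ → refl)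
  reflectDiag-preserves-Adj reflectDiag-preserves-Adj
  (λ p (i , j) → subst (Interval _ _) (sym (U-reflectDiag p)) (Interval-neg i) ,
                 subst (Interval c d) (sym (V-reflectDiag p)) j)
  (λ p (i , j) → Interval-unneg (subst (Interval _ _) (U-reflectDiag p) i) ,
                 subst (Interval c d) (V-reflectDiag p) j)

reflectAntidiag-Bx : ∀ a b c d → Congruent (Bx a b c d) (Bx a b (- d) (- c))
reflectAntidiag-Bx a b c d = congruent-by-inverse reflectAntidiag reflectAntidiag
  involutive involutive reflectAntidiag-preserves-Adj reflectAntidiag-preserves-Adj
  (λ p (i , j) → subst (Interval a b) (sym (U-reflectAntidiag p)) i ,
                 subst (Interval _ _) (sym (V-reflectAntidiag p)) (Interval-neg j))
  (λ p (i , j) → subst (Interval a b) (U-reflectAntidiag p) i ,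
                 Interval-unneg (subst (Interval _ _) (V-reflectAntidiag p) j))
  where
  involutive : ∀ p → reflectAntidiag (reflectAntidiag p) ≡ p
  involutive (x , y) = cong₂ _,_ (neg-involutive x) (neg-involutive y)

Vertex : ℤ → ℤ → ℤ → ℤ → Point → Set
Vertex a b c d p = (U p ≡ a ⊎ U p ≡ b) × (V p ≡ c ⊎ V p ≡ d)

OnTwoExtremalLines : ℤ → ℤ → ℤ → ℤ → Point → Set
OnTwoExtremalLines a b c d p = Σ (Fin 4) λ i → Σ (Fin 4) λ j →
  ¬ SameSet (ExtremalLine a b c d i) (ExtremalLine a b c d j)
  × ExtremalLine a b c d i p × ExtremalLine a b c d j p

intersecting-level-sets-coincide : ∀ (φ : Point → ℤ) {p e e'} → φ p ≡ e → φ p ≡ e' →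
                                   SameSet (λ q → φ q ≡ e) (λ q → φ q ≡ e')
intersecting-level-sets-coincide φ φp≡e φp≡e' q =
  (λ φq≡e → trans φq≡e (trans (sym φp≡e) φp≡e')) , (λ φq≡e' → trans φq≡e' (trans (sym φp≡e') φp≡e))

diagonals-differ : ∀ u v → ¬ SameSet (λ q → U q ≡ u) (λ q → V q ≡ v)
diagonals-differ u v same = 0≢2 (begin
  + 0                     ≡⟨ [u+0]-u≡0 u ⟨
  (u + + 0) - u           ≡⟨ cong (_- u) (trans V[0,u]≡v (sym V[1,u+1]≡v)) ⟩
  ((u + + 1) + + 1) - u   ≡⟨ [u+1+1]-u≡2 u ⟩
  + 2                     ∎)
  where
  open ≡-Reasoning
  0≢2 : + 0 ≢ + 2
  0≢2 ()
  u-0≡u : ∀ u → u - + 0 ≡ u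
  u-0≡u = solve-∀
  [u+1]-1≡u : ∀ u → (u + + 1) - + 1 ≡ u
  [u+1]-1≡u = solve-∀
  [u+0]-u≡0 : ∀ u → (u + + 0) - u ≡ + 0
  [u+0]-u≡0 = solve-∀
  [u+1+1]-u≡2 : ∀ u → ((u + + 1) + + 1) - u ≡ + 2
  [u+1+1]-u≡2 = solve-∀
  V[0,u]≡v : u + + 0 ≡ v
  V[0,u]≡v = proj₁ (same (+ 0 , u)) (u-0≡u u)
  V[1,u+1]≡v : (u + + 1) + + 1 ≡ v
  V[1,u+1]≡v = proj₁ (same (+ 1 , u + + 1)) ([u+1]-1≡u u)

on-two-extremal-lines⇒vertex : ∀ {a b c d p} → OnTwoExtremalLines a b c d p → Vertex a b c d p
on-two-extremal-lines⇒vertex {a} {b} {c} {d} {p} (i , j , distinct , on-i , on-j) = classify i j distinct on-i on-j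
  where
  classify : ∀ i j → ¬ SameSet (ExtremalLine a b c d i) (ExtremalLine a b c d j) →
             ExtremalLine a b c d i p → ExtremalLine a b c d j p → Vertex a b c d p
  classify zero                   zero                   ≠ l l' = ⊥-elim (≠ (intersecting-level-sets-coincide U {p} l l'))
  classify zero                   (suc zero)             ≠ l l' = ⊥-elim (≠ (intersecting-level-sets-coincide U {p} l l'))
  classify (suc zero)             zero                   ≠ l l' = ⊥-elim (≠ (intersecting-level-sets-coincide U {p} l l'))
  classify (suc zero)             (suc zero)             ≠ l l' = ⊥-elim (≠ (intersecting-level-sets-coincide U {p} l l'))
  classify (suc (suc zero))       (suc (suc zero))       ≠ l l' = ⊥-elim (≠ (intersecting-level-sets-coincide V {p} l l'))
  classify (suc (suc zero))       (suc (suc (suc zero))) ≠ l l' = ⊥-elim (≠ (intersecting-level-sets-coincide V {p} l l'))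
  classify (suc (suc (suc zero))) (suc (suc zero))       ≠ l l' = ⊥-elim (≠ (intersecting-level-sets-coincide V {p} l l'))
  classify (suc (suc (suc zero))) (suc (suc (suc zero))) ≠ l l' = ⊥-elim (≠ (intersecting-level-sets-coincide V {p} l l'))
  classify zero                   (suc (suc zero))       _ l l' = inj₁ l , inj₁ l'
  classify zero                   (suc (suc (suc zero))) _ l l' = inj₁ l , inj₂ l'
  classify (suc zero)             (suc (suc zero))       _ l l' = inj₂ l , inj₁ l'
  classify (suc zero)             (suc (suc (suc zero))) _ l l' = inj₂ l , inj₂ l'
  classify (suc (suc zero))       zero                   _ l l' = inj₁ l' , inj₁ l
  classify (suc (suc zero))       (suc zero)             _ l l' = inj₂ l' , inj₁ l
  classify (suc (suc (suc zero))) zero                   _ l l' = inj₁ l' , inj₂ l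
  classify (suc (suc (suc zero))) (suc zero)             _ l l' = inj₂ l' , inj₂ l

vertex⇒on-two-extremal-lines : ∀ {a b c d p} → Vertex a b c d p → OnTwoExtremalLines a b c d p
vertex⇒on-two-extremal-lines {a} {b} {c} {d} (inj₁ onU , inj₁ onV) = zero     , suc (suc zero)       , diagonals-differ a c , onU , onV
vertex⇒on-two-extremal-lines {a} {b} {c} {d} (inj₁ onU , inj₂ onV) = zero     , suc (suc (suc zero)) , diagonals-differ a d , onU , onV
vertex⇒on-two-extremal-lines {a} {b} {c} {d} (inj₂ onU , inj₁ onV) = suc zero , suc (suc zero)       , diagonals-differ b c , onU , onV
vertex⇒on-two-extremal-lines {a} {b} {c} {d} (inj₂ onU , inj₂ onV) = suc zero , suc (suc (suc zero)) , diagonals-differ b d , onU , onV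

vertex⇒corner : ∀ {a b c d p} → a ≤ b → c ≤ d → Vertex a b c d p → IsCorner a b c d p
vertex⇒corner a≤b c≤d vertex@(onU , onV) =
  (endpoint∈Interval a≤b onU , endpoint∈Interval c≤d onV) , vertex⇒on-two-extremal-lines vertex

lower-left-vertex-Bx : ∀ {a b c d} p → U p ≡ a → V p ≡ c → Congruent (Bx a b c d) (Bαβ (b - a) (d - c))
lower-left-vertex-Bx {a} {c = c} p onU onV =
  congruentʳ-Bx (+-inverseʳ a) refl (+-inverseʳ c) refl (translate-Bx p onU onV)

lower-vertex-Bx : ∀ {a b c d} p → U p ≡ a ⊎ U p ≡ b → V p ≡ c → Congruent (Bx a b c d) (Bαβ (b - a) (d - c))
lower-vertex-Bx p (inj₁ onU) onV = lower-left-vertex-Bx p onU onV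
lower-vertex-Bx {a} {b} {c} {d} p (inj₂ onU) onV =
  congruent-trans (reflectDiag-Bx a b c d)
    (congruentʳ-Bx refl (-m--n≡n-m a b) refl refl
      (lower-left-vertex-Bx (reflectDiag p) (trans (U-reflectDiag p) (cong -_ onU)) (trans (V-reflectDiag p) onV)))

vertex-Bx : ∀ {a b c d} p → Vertex a b c d p → Congruent (Bx a b c d) (Bαβ (b - a) (d - c))
vertex-Bx p (onU , inj₁ onV) = lower-vertex-Bx p onU onV
vertex-Bx {a} {b} {c} {d} p (onU , inj₂ onV) =
  congruent-trans (reflectAntidiag-Bx a b c d)
    (congruentʳ-Bx refl refl refl (-m--n≡n-m c d)
      (lower-vertex-Bx (reflectAntidiag p)
        (Sum.map (trans (U-reflectAntidiag p)) (trans (U-reflectAntidiag p)) onU)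
        (trans (V-reflectAntidiag p) (cong -_ onV))))

Odd : ℤ → Set
Odd n = Σ ℤ λ q → n ≡ + 1 + q * + 2

even-or-odd : ∀ n → Σ ℤ (λ q → n ≡ + 0 + q * + 2) ⊎ Odd n
even-or-odd n with n % + 2 | n%d<d n (+ 2) | a≡a%n+[a/n]*n n (+ 2)
... | 0                   | _                       | n≡0+q*2 = inj₁ (n / + 2 , n≡0+q*2)
... | 1                   | _                       | n≡1+q*2 = inj₂ (n / + 2 , n≡1+q*2)
... | ℕ.suc (ℕ.suc _)     | ℕ.s≤s (ℕ.s≤s ())        | _

double⇒Even : ∀ {n} q → n ≡ q * + 2 → Even n
double⇒Even q n≡q*2 = divides ∣ q ∣ (trans (cong ∣_∣ n≡q*2) (abs-* q (+ 2)))

odd-sums⇒even-difference : ∀ m n k → Odd (m + k) → Odd (n + k) → Even (n - m)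
odd-sums⇒even-difference m n k (q , m+k≡1+2q) (q' , n+k≡1+2q') = double⇒Even (q' - q) (begin
  n - m                                 ≡⟨ n-m≡[n+k]-[m+k] n m k ⟩
  (n + k) - (m + k)                     ≡⟨ cong₂ _-_ n+k≡1+2q' m+k≡1+2q ⟩
  (+ 1 + q' * + 2) - (+ 1 + q * + 2)    ≡⟨ [1+2q']-[1+2q]≡[q'-q]*2 q' q ⟩
  (q' - q) * + 2                        ∎)
  where
  open ≡-Reasoning
  n-m≡[n+k]-[m+k] : ∀ n m k → n - m ≡ (n + k) - (m + k)
  n-m≡[n+k]-[m+k] = solve-∀
  [1+2q']-[1+2q]≡[q'-q]*2 : ∀ q' q → (+ 1 + q' * + 2) - (+ 1 + q * + 2) ≡ (q' - q) * + 2
  [1+2q']-[1+2q]≡[q'-q]*2 = solve-∀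

lattice-point : ∀ {u v} q → u + v ≡ + 0 + q * + 2 → Σ Point λ p → U p ≡ u × V p ≡ v
lattice-point {u} {v} q u+v≡2q = (q - u , q) , q-[q-u]≡u q u , (begin
  q + (q - u)         ≡⟨ q+[q-u]≡[0+2q]-u q u ⟩
  (+ 0 + q * + 2) - u ≡⟨ cong (_- u) u+v≡2q ⟨
  (u + v) - u         ≡⟨ [u+v]-u≡v u v ⟩
  v                   ∎)
  where
  open ≡-Reasoning
  q-[q-u]≡u : ∀ q u → q - (q - u) ≡ u
  q-[q-u]≡u = solve-∀
  q+[q-u]≡[0+2q]-u : ∀ q u → q + (q - u) ≡ (+ 0 + q * + 2) - u
  q+[q-u]≡[0+2q]-u = solve-∀
  [u+v]-u≡v : ∀ u v → (u + v) - u ≡ v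
  [u+v]-u≡v = solve-∀

no-corner⇒odd-sum : ∀ {a b c d u v} → a ≤ b → c ≤ d → ¬ HasCorner a b c d →
                    u ≡ a ⊎ u ≡ b → v ≡ c ⊎ v ≡ d → Odd (u + v)
no-corner⇒odd-sum {u = u} {v} a≤b c≤d no-corner u-endpoint v-endpoint with even-or-odd (u + v)
... | inj₂ odd = odd
... | inj₁ (q , u+v≡2q) =
  let (p , onU , onV) = lattice-point q u+v≡2q
  in ⊥-elim (no-corner (p , vertex⇒corner a≤b c≤d
       (Sum.map (trans onU) (trans onU) u-endpoint , Sum.map (trans onV) (trans onV) v-endpoint)))

odd-vertex-Bx : ∀ {a b c d} → Odd (a + c) → Congruent (Bx a b c d) (B̂αβ (b - a) (d - c))
odd-vertex-Bx {a} {b} {c} {d} (q , a+c≡1+2q) =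
  let (p , onU , onV) = lattice-point (q + + 1) (begin
        a + (c + + 1)        ≡⟨ +-assoc a c (+ 1) ⟨
        (a + c) + + 1        ≡⟨ cong (_+ + 1) a+c≡1+2q ⟩
        (+ 1 + q * + 2) + + 1 ≡⟨ [1+2q]+1≡0+[q+1]*2 q ⟩
        + 0 + (q + + 1) * + 2 ∎)
  in congruentʳ-Bx (+-inverseʳ a) refl (c-[c+1]≡-1 c) (d-[c+1]≡[d-c]-1 d c) (translate-Bx p onU onV)
  where
  open ≡-Reasoning
  [1+2q]+1≡0+[q+1]*2 : ∀ q → (+ 1 + q * + 2) + + 1 ≡ + 0 + (q + + 1) * + 2
  [1+2q]+1≡0+[q+1]*2 = solve-∀
  c-[c+1]≡-1 : ∀ c → c - (c + + 1) ≡ - + 1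
  c-[c+1]≡-1 = solve-∀
  d-[c+1]≡[d-c]-1 : ∀ d c → d - (c + + 1) ≡ (d - c) - + 1
  d-[c+1]≡[d-c]-1 = solve-∀

proposition5p6 : (a b c d : ℤ) → IsBox a b c d →
    (¬ HasCorner a b c d →
       Even (b - a) × Even (d - c) × Congruent (Bx a b c d) (B̂αβ (b - a) (d - c)))
    × (HasCorner a b c d → Congruent (Bx a b c d) (Bαβ (b - a) (d - c)))
proposition5p6 a b c d ((_ , (a≤u , u≤b) , (c≤v , v≤d)) , _) = without-corner , with-corner
  where
  a≤b = ≤-trans a≤u u≤b
  c≤d = ≤-trans c≤v v≤d
  without-corner : ¬ HasCorner a b c d →
                   Even (b - a) × Even (d - c) × Congruent (Bx a b c d) (B̂αβ (b - a) (d - c))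
  without-corner no-corner =
    odd-sums⇒even-difference a b c (odd-sum (inj₁ refl) (inj₁ refl)) (odd-sum (inj₂ refl) (inj₁ refl)) ,
    odd-sums⇒even-difference c d a (subst Odd (+-comm a c) (odd-sum (inj₁ refl) (inj₁ refl)))
                                   (subst Odd (+-comm a d) (odd-sum (inj₁ refl) (inj₂ refl))) ,
    odd-vertex-Bx (odd-sum (inj₁ refl) (inj₁ refl))
    where
    odd-sum : ∀ {u v} → u ≡ a ⊎ u ≡ b → v ≡ c ⊎ v ≡ d → Odd (u + v)
    odd-sum = no-corner⇒odd-sum a≤b c≤d no-corner
  with-corner : HasCorner a b c d → Congruent (Bx a b c d) (Bαβ (b - a) (d - c))
  with-corner (p , _ , on-lines) = vertex-Bx p (on-two-extremal-lines⇒vertex on-lines)
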